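{- Let $G$ be a finite simple $3$-connected graph and let $L$ be a degree-assignment for $G$. Suppose $x$ and $y$ are non-adjacent vertices of $G$ that are both special, with $a$ a special color for $x$ and $b$ a special color for $y$ (possibly $a=b$). Then all $L$-colorings $\varphi$ of $G$ satisfying $\varphi(x)=a$ or $\varphi(y)=b$ are pairwise $L$-equivalent.
   Context: A list-assignment $L$ for a graph $G$ assigns to each vertex $v\in V(G)$ a set (list) of colors $L(v)$. It is a degree-assignment if $|L(v)|\ge d(v)$ for every $v\in V(G)$. An $L$-coloring of $G$ is a proper coloring $\varphi$ of $G$ with $\varphi(v)\in L(v)$ for every $v$. A vertex $v$ is special (with respect to $L$) if $v$ has a neighbor $u$ with $L(v)\setminus L(u)\neq\emptyset$; every color in $L(v)\setminus L(u)$ for such a neighbor $u$ is called a special color for $v$. Given a coloring, a Kempe chain on colors $a$ and $b$ is a connected component of the subgraph induced by the vertices colored $a$ or $b$; a Kempe change interchanges colors $a$ and $b$ on one Kempe chain. For an $L$-coloring, a Kempe change is $L$-valid if the result is again an $L$-coloring. Two $L$-colorings are $L$-equivalent if one can be obtained from the other by a finite sequence of $L$-valid Kempe changes. -}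

module Defs where

open import Data.Nat using (ℕ; zero; suc; _+_; _≤_; _<_; _≟_)
open import Data.Bool using (Bool; true; false; T; if_then_else_)
open import Data.Fin using (Fin)
open import Data.List using (List; length; map; allFin)
open import Data.Nat.ListAction using (sum)
open import Data.List.Membership.Propositional using (_∈_; _∉_)
open import Data.List.Relation.Unary.Unique.Propositional using (Unique)
open import Data.Product using (Σ; ∃; _×_; _,_)
open import Data.Sum using (_⊎_)
open import Relation.Nullary using (¬_; does)
open import Relation.Binary.PropositionalEquality using (_≡_; _≢_)
open import Relation.Binary.Construct.Closure.ReflexiveTransitive using (Star)

record Graph (n : ℕ) : Set where
  field
    adj   : Fin n → Fin n → Bool
    sym   : ∀ u v → adj u v ≡ adj v u
    loopless : ∀ v → adj v v ≡ false

module _ {n : ℕ} (G : Graph n) where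
  open Graph G

  Adj : Fin n → Fin n → Set
  Adj u v = T (adj u v)

  deg : Fin n → ℕ
  deg v = sum (map (λ u → if adj v u then 1 else 0) (allFin n))

  data Reach (P : Fin n → Set) : Fin n → Fin n → Set where
    here : ∀ {u} → P u → Reach P u u
    step : ∀ {u v w} → P u → Adj u v → Reach P v w → Reach P u w

  ConnectedWithout : List (Fin n) → Set
  ConnectedWithout X = ∀ u w → u ∉ X → w ∉ X → Reach (λ z → z ∉ X) u w

  KConnected : ℕ → Set
  KConnected k = (k < n) × (∀ (X : List (Fin n)) → length X < k → ConnectedWithout X)

  ThreeConnected : Set
  ThreeConnected = KConnected 3

  -- Lists of colors (colors are natural numbers); each list is a set,
  -- i.e. has no repetitions, so |L(v)| = length (L v).
  ListAssignment : Set
  ListAssignment = Fin n → List ℕ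

  IsListAssignment : ListAssignment → Set
  IsListAssignment L = ∀ v → Unique (L v)

  DegreeAssignment : ListAssignment → Set
  DegreeAssignment L = ∀ v → deg v ≤ length (L v)

  SpecialColor : ListAssignment → Fin n → ℕ → Set
  SpecialColor L v c = ∃ λ u → Adj v u × c ∈ L v × c ∉ L u

  Special : ListAssignment → Fin n → Set
  Special L v = ∃ λ c → SpecialColor L v c

  Coloring : Set
  Coloring = Fin n → ℕ

  Proper : Coloring → Set
  Proper φ = ∀ u v → Adj u v → φ u ≢ φ v

  LColoring : ListAssignment → Coloring → Set
  LColoring L φ = Proper φ × (∀ v → φ v ∈ L v)

  swapCol : ℕ → ℕ → ℕ → ℕ
  swapCol a b c = if does (c ≟ a) then b else (if does (c ≟ b) then a else c)

  Colored₂ : Coloring → ℕ → ℕ → Fin n → Set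
  Colored₂ φ a b z = (φ z ≡ a) ⊎ (φ z ≡ b)

  InKempeChain : Coloring → ℕ → ℕ → Fin n → Fin n → Set
  InKempeChain φ a b v w = Reach (Colored₂ φ a b) v w

  KempeChange : Coloring → Coloring → Set
  KempeChange φ ψ =
    Σ ℕ λ a → Σ ℕ λ b → Σ (Fin n) λ v →
      Colored₂ φ a b v ×
      (∀ w → (InKempeChain φ a b v w → ψ w ≡ swapCol a b (φ w)) ×
             (¬ InKempeChain φ a b v w → ψ w ≡ φ w))

  LValidKempe : ListAssignment → Coloring → Coloring → Set
  LValidKempe L φ ψ = LColoring L φ × LColoring L ψ × KempeChange φ ψ

  LEquivalent : ListAssignment → Coloring → Coloring → Set
  LEquivalent L = Star (LValidKempe L)

{-# OPTIONS --safe #-}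
module Submission where

-- Call v slack if deg v < |L v|. If every vertex is connected to a slack vertex, all L-colourings are
-- L-equivalent: delete the edges at a non-isolated slack vertex v, use induction, and lift each Kempe
-- change of the smaller graph to G. Lifting is where slack enters: if v is coloured inside the chain's
-- pair {a, b} and has no free colour, then the swapped colour e of v is carried by at most one neighbour
-- w₀ (and then e ∈ L v), so v either stays out of the chain or joins it through w₀, recoloured e.
-- Precolouring x with its special colour a (x gets the list [a], and a is deleted from the lists of its
-- neighbours) keeps a degree-assignment in which x and the neighbour u with a ∉ L(u) are slack; as G - x
-- is connected, all colourings with φ(x) = a are equivalent, and likewise those with φ(y) = b. Since
-- G - {x, y} is connected too, precolouring both x and y yields a colouring lying in both classes.

open import Defs
open import Data.Nat using (ℕ; suc; _+_; _≤_; _<_; _≟_; _<?_; z≤n; s≤s)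
open import Induction.WellFounded using (Acc; acc)
open import Data.Nat.Induction using (<-wellFounded)
open import Data.Nat.Properties
open import Data.Bool using (Bool; true; false; T; if_then_else_; not; _∧_)
open import Data.Bool.Properties using (T-∧; T-not-≡)
open import Data.Fin using (Fin) renaming (_≟_ to _≟ᶠ_)
import Data.Fin.Properties as Fin
open import Data.List using (List; []; _∷_; [_]; _++_; length; map; filter; filterᵇ; allFin)
open import Data.Nat.ListAction using (sum)
open import Data.List.Properties using (filter-all; filter-accept; filter-reject; length-map; length-++)
open import Data.List.Membership.Propositional using (_∈_; _∉_; find; lose)
open import Data.List.Membership.DecPropositional _≟_ using (_∈?_)
open import Data.List.Membership.Propositional.Properties
  using (∈-filter⁺; ∈-filter⁻; ∈-allFin; ∈-map⁺; ∈-++⁺ˡ; ∈-++⁺ʳ)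
open import Data.List.Relation.Unary.Any using (here; there)
import Data.List.Relation.Unary.Any as Any
import Data.List.Relation.Unary.All as All
open import Data.List.Relation.Unary.All.Properties using (¬Any⇒All¬; All¬⇒¬Any)
open import Data.List.Relation.Unary.Unique.Propositional using (Unique; []; _∷_)
import Data.List.Relation.Unary.Unique.Propositional.Properties as Unique
open import Data.List.Relation.Binary.Subset.Propositional using (_⊆_)
open import Data.Product using (Σ; ∃; _×_; _,_; proj₁; proj₂)
open import Data.Sum using (_⊎_; inj₁; inj₂)
open import Data.Empty using (⊥-elim)
open import Data.Unit using (⊤; tt)
open import Function using (_∘_)
open import Function.Bundles using (module Equivalence)
open import Relation.Nullary using (¬_; does; Dec; yes; no; ¬?; contradiction)
open import Relation.Nullary.Decidable
  using (dec-true; dec-false; T?; decidable-stable; _⊎-dec_; _×-dec_; _→-dec_)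
open import Relation.Binary.Construct.Closure.ReflexiveTransitive using (ε; _◅_; _◅◅_; return)
import Relation.Binary.Construct.Closure.ReflexiveTransitive as Star
open import Relation.Binary.PropositionalEquality
  using (_≡_; _≢_; refl; sym; trans; cong; subst; ≢-sym)

delete : ℕ → List ℕ → List ℕ
delete a = filter (λ c → ¬? (c ≟ a))

module _ {a : ℕ} where

  ∈-delete⁺ : ∀ {c xs} → c ∈ xs → c ≢ a → c ∈ delete a xs
  ∈-delete⁺ = ∈-filter⁺ (λ c → ¬? (c ≟ a))

  ∈-delete⁻ : ∀ {c xs} → c ∈ delete a xs → c ∈ xs × c ≢ a
  ∈-delete⁻ = ∈-filter⁻ (λ c → ¬? (c ≟ a))

  delete-∉ : ∀ {xs} → a ∉ xs → delete a xs ≡ xs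
  delete-∉ a∉xs = filter-all (λ c → ¬? (c ≟ a)) (All.map ≢-sym (¬Any⇒All¬ _ a∉xs))

  Unique-delete : ∀ {xs} → Unique xs → Unique (delete a xs)
  Unique-delete = Unique.filter⁺ (λ c → ¬? (c ≟ a))

  length-delete : ∀ {xs} → Unique xs → length xs ≤ suc (length (delete a xs))
  length-delete {[]} _ = z≤n
  length-delete {c ∷ xs} (c∉xs ∷ u) with c ≟ a
  ... | yes refl rewrite filter-reject (λ d → ¬? (d ≟ a)) {xs = xs} (λ c≢c → c≢c refl)
                       | delete-∉ (All¬⇒¬Any c∉xs) = ≤-refl
  ... | no c≢a rewrite filter-accept (λ d → ¬? (d ≟ a)) {xs = xs} c≢a = s≤s (length-delete u)

Unique-⊆⇒length≤ : ∀ {xs ys : List ℕ} → Unique xs → xs ⊆ ys → length xs ≤ length ys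
Unique-⊆⇒length≤ {[]} _ _ = z≤n
Unique-⊆⇒length≤ {_ ∷ _} {[]} _ xs⊆[] with () ← xs⊆[] (here refl)
Unique-⊆⇒length≤ {xs@(_ ∷ _)} {g ∷ ys} u xs⊆g∷ys =
  ≤-trans (length-delete u) (s≤s (Unique-⊆⇒length≤ (Unique-delete u) delete⊆ys))
  where
  delete⊆ys : delete g xs ⊆ ys
  delete⊆ys c∈ with ∈-delete⁻ c∈
  ... | c∈xs , c≢g with xs⊆g∷ys c∈xs
  ...   | here c≡g = contradiction c≡g c≢g
  ...   | there c∈ys = c∈ys

count : {A : Set} → (A → Bool) → List A → ℕ
count p xs = sum (map (λ u → if p u then 1 else 0) xs)

module _ {A : Set} where

  sum-map-mono-≤ : ∀ {f g : A → ℕ} → (∀ u → f u ≤ g u) → ∀ xs → sum (map f xs) ≤ sum (map g xs)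
  sum-map-mono-≤ f≤g [] = z≤n
  sum-map-mono-≤ f≤g (u ∷ xs) = +-mono-≤ (f≤g u) (sum-map-mono-≤ f≤g xs)

  sum-map-mono-< : ∀ {f g : A → ℕ} → (∀ u → f u ≤ g u) → ∀ {u xs} → u ∈ xs → f u < g u →
                   sum (map f xs) < sum (map g xs)
  sum-map-mono-< f≤g {xs = _ ∷ xs} (here refl) fu<gu = +-mono-<-≤ fu<gu (sum-map-mono-≤ f≤g xs)
  sum-map-mono-< f≤g {xs = u ∷ _} (there u∈) fu<gu = +-mono-≤-< (f≤g u) (sum-map-mono-< f≤g u∈ fu<gu)

  module _ {p q : A → Bool} (p⇒q : ∀ u → T (p u) → T (q u)) where

    private
      indicator-mono : ∀ u → (if p u then 1 else 0) ≤ (if q u then 1 else 0)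
      indicator-mono u with p u | q u | p⇒q u
      ... | false | _ | _ = z≤n
      ... | true | true | _ = ≤-refl
      ... | true | false | pu⇒qu = ⊥-elim (pu⇒qu _)

    count-mono-≤ : ∀ xs → count p xs ≤ count q xs
    count-mono-≤ = sum-map-mono-≤ indicator-mono

    count-mono-< : ∀ {u xs} → u ∈ xs → ¬ T (p u) → T (q u) → count p xs < count q xs
    count-mono-< {u} u∈ ¬pu qu = sum-map-mono-< indicator-mono u∈ (indicator-< ¬pu qu)
      where
      indicator-< : ∀ {b c : Bool} → ¬ T b → T c → (if b then 1 else 0) < (if c then 1 else 0)
      indicator-< {false} {true} _ _ = s≤s z≤n
      indicator-< {true} ¬b _ = ⊥-elim (¬b _)

  count-none : ∀ {p : A → Bool} → (∀ u → ¬ T (p u)) → ∀ xs → count p xs ≡ 0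
  count-none ¬p [] = refl
  count-none {p} ¬p (u ∷ xs) with p u | ¬p u
  ... | false | _ = count-none ¬p xs
  ... | true | ¬pu = ⊥-elim (¬pu _)

  count-pos : ∀ {p : A → Bool} {u xs} → u ∈ xs → T (p u) → 0 < count p xs
  count-pos {p} {xs = xs} u∈ pu =
    subst (_< count p xs) (count-none {λ _ → false} (λ _ ()) xs)
          (count-mono-< {λ _ → false} (λ _ ()) u∈ (λ ()) pu)

  length-filterᵇ : ∀ (p : A → Bool) xs → length (filterᵇ p xs) ≡ count p xs
  length-filterᵇ p [] = refl
  length-filterᵇ p (u ∷ xs) with p u
  ... | true = cong suc (length-filterᵇ p xs)
  ... | false = length-filterᵇ p xs

Col₂ : ℕ → ℕ → ℕ → Set
Col₂ a b c = (c ≡ a) ⊎ (c ≡ b)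

module _ {n : ℕ} (G : Graph n) where

  swapCol-a : ∀ a b → swapCol G a b a ≡ b
  swapCol-a a b rewrite dec-true (a ≟ a) refl = refl

  swapCol-b : ∀ {a b} → a ≢ b → swapCol G a b b ≡ a
  swapCol-b {a} {b} a≢b rewrite dec-false (b ≟ a) (≢-sym a≢b) | dec-true (b ≟ b) refl = refl

  swapCol-same : ∀ a c → swapCol G a a c ≡ c
  swapCol-same a c with c ≟ a
  ... | yes refl = swapCol-a c c
  ... | no c≢a rewrite dec-false (c ≟ a) c≢a = refl

  module _ {a b : ℕ} (a≢b : a ≢ b) where

    swapCol-col : ∀ {c} → Col₂ a b c → Col₂ a b (swapCol G a b c)
    swapCol-col (inj₁ refl) = inj₂ (swapCol-a a b)
    swapCol-col (inj₂ refl) = inj₁ (swapCol-b a≢b)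

    swapCol-≢ : ∀ {c} → Col₂ a b c → swapCol G a b c ≢ c
    swapCol-≢ (inj₁ refl) b≡a = a≢b (trans (sym b≡a) (swapCol-a a b))
    swapCol-≢ (inj₂ refl) a≡b = a≢b (trans (sym (swapCol-b a≢b)) a≡b)

    Col₂-other : ∀ {c d} → Col₂ a b c → Col₂ a b d → d ≢ c → d ≡ swapCol G a b c
    Col₂-other (inj₁ refl) (inj₁ refl) d≢c = contradiction refl d≢c
    Col₂-other (inj₁ refl) (inj₂ refl) _ = sym (swapCol-a a b)
    Col₂-other (inj₂ refl) (inj₁ refl) _ = sym (swapCol-b a≢b)
    Col₂-other (inj₂ refl) (inj₂ refl) d≢c = contradiction refl d≢c

    swapCol-injective : ∀ {c d} → Col₂ a b c → Col₂ a b d → swapCol G a b c ≡ swapCol G a b d → c ≡ d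
    swapCol-injective {c} {d} col-c col-d eq with c ≟ d
    ... | yes c≡d = c≡d
    ... | no c≢d = contradiction (trans eq (sym (Col₂-other col-d col-c c≢d))) (swapCol-≢ col-c)

module _ {n : ℕ} (G : Graph n) where

  Adj-sym : ∀ {u w} → Adj G u w → Adj G w u
  Adj-sym {u} {w} = subst T (Graph.sym G u w)

  Adj-irrefl : ∀ {u w} → Adj G u w → u ≢ w
  Adj-irrefl {u} uu refl = subst T (Graph.loopless G u) uu

  deg-pos : ∀ {u w} → Adj G u w → 0 < deg G u
  deg-pos {w = w} = count-pos (∈-allFin w)

  Reach-first : ∀ {P p q} → Reach G P p q → P p
  Reach-first (here Pp) = Pp
  Reach-first (step Pp _ _) = Pp

  Reach-last : ∀ {P p q} → Reach G P p q → P q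
  Reach-last (here Pq) = Pq
  Reach-last (step _ _ r) = Reach-last r

  Reach-snoc : ∀ {P p u w} → Reach G P p u → Adj G u w → P w → Reach G P p w
  Reach-snoc (here Pu) uw Pw = step Pu uw (here Pw)
  Reach-snoc (step Pp pv r) uw Pw = step Pp pv (Reach-snoc r uw Pw)

  Reach-map : ∀ {P Q : Fin n → Set} → (∀ {z} → P z → Q z) → ∀ {p q} → Reach G P p q → Reach G Q p q
  Reach-map P⇒Q (here Pp) = here (P⇒Q Pp)
  Reach-map P⇒Q (step Pp pv r) = step (P⇒Q Pp) pv (Reach-map P⇒Q r)

  Reach-invariant : ∀ {P : Fin n → Set} (Q : Fin n → Set) →
    (∀ {u w} → Q u → P u → Adj G u w → P w → Q w) → ∀ {p q} → Q p → Reach G P p q → Q q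
  Reach-invariant Q step-Q Qp (here _) = Qp
  Reach-invariant Q step-Q Qp (step Pp pv r) = Reach-invariant Q step-Q (step-Q Qp Pp pv (Reach-first r)) r

isolate : ∀ {n} → Graph n → Fin n → Graph n
isolate {n} G x = record { adj = adj ; sym = sym′ ; loopless = loopless }
  where
  off : Fin n → Bool
  off u = not (does (u ≟ᶠ x))
  adj : Fin n → Fin n → Bool
  adj u w = off u ∧ (off w ∧ Graph.adj G u w)
  sym′ : ∀ u w → adj u w ≡ adj w u
  sym′ u w rewrite Graph.sym G u w with off u | off w
  ... | true | true = refl
  ... | true | false = refl
  ... | false | true = refl
  ... | false | false = refl
  loopless : ∀ v → adj v v ≡ false
  loopless v rewrite Graph.loopless G v with off v
  ... | true = refl
  ... | false = refl

module _ {n : ℕ} (G : Graph n) (x : Fin n) where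

  Adj-isolate⁻ : ∀ {u w} → Adj (isolate G x) u w → Adj G u w × u ≢ x × w ≢ x
  Adj-isolate⁻ {u} {w} uw with u ≟ᶠ x | w ≟ᶠ x
  ... | no u≢x | no w≢x = uw , u≢x , w≢x

  Adj-isolate⁺ : ∀ {u w} → u ≢ x → w ≢ x → Adj G u w → Adj (isolate G x) u w
  Adj-isolate⁺ {u} {w} u≢x w≢x uw with u ≟ᶠ x | w ≟ᶠ x
  ... | yes u≡x | _ = contradiction u≡x u≢x
  ... | no _ | yes w≡x = contradiction w≡x w≢x
  ... | no _ | no _ = uw

  deg-isolate-≤ : ∀ u → deg (isolate G x) u ≤ deg G u
  deg-isolate-≤ u = count-mono-≤ (λ w uw → proj₁ (Adj-isolate⁻ {u} {w} uw)) (allFin n)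

  deg-isolate-< : ∀ {u} → Adj G u x → deg (isolate G x) u < deg G u
  deg-isolate-< {u} ux = count-mono-< (λ w uw → proj₁ (Adj-isolate⁻ {u} {w} uw)) (∈-allFin x)
                           (λ ux′ → proj₂ (proj₂ (Adj-isolate⁻ {u} ux′)) refl) ux

  deg-isolate-self : deg (isolate G x) x ≡ 0
  deg-isolate-self = count-none (λ w xw → proj₁ (proj₂ (Adj-isolate⁻ {x} {w} xw)) refl) (allFin n)

  LColoring-isolate : ∀ {L φ} → LColoring G L φ → LColoring (isolate G x) L φ
  LColoring-isolate (proper , inL) = (λ u w uw → proper u w (proj₁ (Adj-isolate⁻ uw))) , inL

  Reach-isolate⁺ : ∀ {P : Fin n → Set} → (∀ {z} → P z → z ≢ x) →
    ∀ {p q} → Reach G P p q → Reach (isolate G x) P p q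
  Reach-isolate⁺ P⇒≢x (here Pp) = here Pp
  Reach-isolate⁺ P⇒≢x (step Pp pv r) =
    step Pp (Adj-isolate⁺ (P⇒≢x Pp) (P⇒≢x (Reach-first G r)) pv) (Reach-isolate⁺ P⇒≢x r)

  Reach-isolate⁻ : ∀ {P Q : Fin n → Set} → (∀ {u} → u ≢ x → P u → Q u) →
    ∀ {p q} → p ≢ x → Reach (isolate G x) P p q → Reach G Q p q
  Reach-isolate⁻ P⇒Q p≢x (here Pp) = here (P⇒Q p≢x Pp)
  Reach-isolate⁻ P⇒Q p≢x (step {p} {v} Pp pv r) =
    step (P⇒Q p≢x Pp) (proj₁ pv′) (Reach-isolate⁻ P⇒Q (proj₂ (proj₂ pv′)) r)
    where
    pv′ : Adj G p v × p ≢ x × v ≢ x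
    pv′ = Adj-isolate⁻ pv

  Reach-isolate-≢ : ∀ {P p q} → Reach (isolate G x) P p q → p ≢ x → q ≢ x
  Reach-isolate-≢ r p≢x =
    Reach-invariant (isolate G x) (_≢ x) (λ {u} {w} _ _ uw _ → proj₂ (proj₂ (Adj-isolate⁻ {u} {w} uw))) p≢x r

  Reach-isolate-self : ∀ {P q} → Reach (isolate G x) P x q → q ≡ x
  Reach-isolate-self r = Reach-invariant (isolate G x) (_≡ x) stays-at-x refl r
    where
    stays-at-x : ∀ {u w} → u ≡ x → _ → Adj (isolate G x) u w → _ → w ≡ x
    stays-at-x {u} {w} u≡x _ uw _ = contradiction u≡x (proj₁ (proj₂ (Adj-isolate⁻ {u} {w} uw)))

recolour : ∀ {n} → (Fin n → ℕ) → Fin n → ℕ → Fin n → ℕ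
recolour φ v c w = if does (w ≟ᶠ v) then c else φ w

module _ {n} {φ : Fin n → ℕ} {v : Fin n} {c : ℕ} where

  recolour-self : recolour φ v c v ≡ c
  recolour-self rewrite dec-true (v ≟ᶠ v) refl = refl

  recolour-other : ∀ {w} → w ≢ v → recolour φ v c w ≡ φ w
  recolour-other {w} w≢v rewrite dec-false (w ≟ᶠ v) w≢v = refl

ChainSwap : ∀ {n} (G : Graph n) → Coloring G → Coloring G → ℕ → ℕ → Fin n → Set
ChainSwap G φ ψ a b s = ∀ w → (InKempeChain G φ a b s w → ψ w ≡ swapCol G a b (φ w)) ×
                              (¬ InKempeChain G φ a b s w → ψ w ≡ φ w)

ChainSwap-same : ∀ {n} (G : Graph n) {σ σ′ a s} → ChainSwap G σ σ′ a a s → ∀ w → σ′ w ≡ σ w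
ChainSwap-same G {σ} {σ′} {a} swap w = decidable-stable (σ′ w ≟ σ w) λ σ′w≢σw →
  σ′w≢σw (proj₂ (swap w) (λ c → σ′w≢σw (trans (proj₁ (swap w) c) (swapCol-same G a (σ w)))))

AgreeOff : ∀ {n} → Fin n → (Fin n → ℕ) → (Fin n → ℕ) → Set
AgreeOff v φ σ = ∀ w → w ≢ v → φ w ≡ σ w

recolour-agrees : ∀ {n} {σ : Fin n → ℕ} {v c} → AgreeOff v (recolour σ v c) σ
recolour-agrees {σ = σ} w w≢v = recolour-other {φ = σ} w≢v

module _ {n : ℕ} (G : Graph n) (v : Fin n) where

  UnusedAround : Coloring G → ℕ → Set
  UnusedAround φ f = ∀ u → Adj G v u → φ u ≢ f

  UnusedAround? : ∀ φ f → Dec (UnusedAround φ f)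
  UnusedAround? φ f = Fin.all? (λ u → T? (Graph.adj G v u) →-dec ¬? (φ u ≟ f))

  ¬UnusedAround⇒used : ∀ {φ f} → ¬ UnusedAround φ f → ∃ λ u → Adj G v u × φ u ≡ f
  ¬UnusedAround⇒used {φ} {f} ¬unused
    with u , ¬[vu⇒φu≢f] ← Fin.¬∀⟶∃¬ n _ (λ u → T? (Graph.adj G v u) →-dec ¬? (φ u ≟ f)) ¬unused =
    u , decidable-stable (T? _) (λ ¬vu → ¬[vu⇒φu≢f] (λ vu → contradiction vu ¬vu))
      , decidable-stable (φ u ≟ f) (λ φu≢f → ¬[vu⇒φu≢f] (λ _ → φu≢f))

module _ {n : ℕ} (G : Graph n) (L : ListAssignment G) where

  LColoring-recolour : ∀ {σ v c} → LColoring (isolate G v) L σ → c ∈ L v → UnusedAround G v σ c →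
    LColoring G L (recolour σ v c)
  LColoring-recolour {σ} {v} {c} (proper , inL) c∈Lv c-free = proper′ , inL′
    where
    inL′ : ∀ w → recolour σ v c w ∈ L w
    inL′ w with w ≟ᶠ v
    ... | yes refl = c∈Lv
    ... | no _ = inL w
    proper′ : Proper G (recolour σ v c)
    proper′ u w uw with u ≟ᶠ v | w ≟ᶠ v
    ... | yes refl | yes refl = contradiction refl (Adj-irrefl G uw)
    ... | yes refl | no _ = λ c≡σw → c-free w uw (sym c≡σw)
    ... | no _ | yes refl = c-free u (Adj-sym G uw)
    ... | no u≢v | no w≢v = proper u w (Adj-isolate⁺ G v u≢v w≢v uw)

  singleVertexKempe : ∀ {φ ψ v} → LColoring G L φ → LColoring G L ψ → AgreeOff v ψ φ →
    UnusedAround G v φ (ψ v) → LValidKempe G L φ ψ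
  singleVertexKempe {φ} {ψ} {v} lφ lψ ψ≈φ ψv-free = lφ , lψ , φ v , ψ v , v , inj₁ refl , swap
    where
    chain-at-v : ∀ {w} → InKempeChain G φ (φ v) (ψ v) v w → w ≡ v
    chain-at-v = Reach-invariant G (_≡ v) leaves-v refl
      where
      leaves-v : ∀ {u w} → u ≡ v → _ → Adj G u w → Colored₂ G φ (φ v) (ψ v) w → w ≡ v
      leaves-v refl _ vw (inj₁ φw≡φv) = contradiction (sym φw≡φv) (proj₁ lφ _ _ vw)
      leaves-v refl _ vw (inj₂ φw≡ψv) = contradiction φw≡ψv (ψv-free _ vw)
    swap : ChainSwap G φ ψ (φ v) (ψ v) v
    swap w = in-chain , off-chain
      where
      in-chain : InKempeChain G φ (φ v) (ψ v) v w → ψ w ≡ swapCol G (φ v) (ψ v) (φ w)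
      in-chain c with refl ← chain-at-v c = sym (swapCol-a G (φ v) (ψ v))
      off-chain : ¬ InKempeChain G φ (φ v) (ψ v) v w → ψ w ≡ φ w
      off-chain ¬c = ψ≈φ w (λ { refl → ¬c (here (inj₁ refl)) })

module _ {n : ℕ} (G : Graph n) (v : Fin n) where

  colours : Coloring G → (Fin n → Bool) → List ℕ
  colours φ p = map φ (filterᵇ p (allFin n))

  length-colours : ∀ φ p → length (colours φ p) ≡ count p (allFin n)
  length-colours φ p = trans (length-map φ (filterᵇ p (allFin n))) (length-filterᵇ p (allFin n))

  ∈-colours : ∀ {φ p w} → T (p w) → φ w ∈ colours φ p
  ∈-colours {φ} {p} {w} pw = ∈-map⁺ φ (∈-filter⁺ (T? ∘ p) (∈-allFin w) pw)

  module _ (L : ListAssignment G) (unique-Lv : Unique (L v)) where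

    length-≤-covering : ∀ (extra : List ℕ) φ p → (∀ {f} → f ∈ L v → f ∈ extra ⊎ ∃ λ w → T (p w) × φ w ≡ f) →
      length (L v) ≤ length extra + count p (allFin n)
    length-≤-covering extra φ p covered = begin
      length (L v)                        ≤⟨ Unique-⊆⇒length≤ unique-Lv Lv⊆ ⟩
      length (extra ++ colours φ p)       ≡⟨ length-++ extra ⟩
      length extra + length (colours φ p) ≡⟨ cong (length extra +_) (length-colours φ p) ⟩
      length extra + count p (allFin n)   ∎
      where
      open ≤-Reasoning
      Lv⊆ : L v ⊆ extra ++ colours φ p
      Lv⊆ f∈Lv with covered f∈Lv
      ... | inj₁ f∈extra = ∈-++⁺ˡ f∈extra
      ... | inj₂ (w , pw , refl) = ∈-++⁺ʳ extra (∈-colours pw)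

    module _ (slack : deg G v < length (L v)) where

      free-colour : ∀ φ → ∃ λ f → f ∈ L v × UnusedAround G v φ f
      free-colour φ with Any.any? (UnusedAround? G v φ) (L v)
      ... | yes ∃unused = find ∃unused
      ... | no ¬∃unused = contradiction (length-≤-covering [] φ (Graph.adj G v) covered) (<⇒≱ slack)
        where
        covered : ∀ {f} → f ∈ L v → f ∈ [] ⊎ ∃ λ w → T (Graph.adj G v w) × φ w ≡ f
        covered f∈Lv = inj₂ (¬UnusedAround⇒used G v (¬∃unused ∘ lose f∈Lv))

      slack-uncovered : ∀ (φ : Coloring G) {r} → Adj G v r →
        ¬ (∀ f → f ∈ L v → f ≡ φ v ⊎ ∃ λ w → Adj G v w × w ≢ r × φ w ≡ f)
      slack-uncovered φ {r} vr covered =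
        <⇒≱ slack (≤-trans (length-≤-covering [ φ v ] φ others covered′) fewer)
        where
        others : Fin n → Bool
        others w = Graph.adj G v w ∧ not (does (w ≟ᶠ r))
        fewer : 1 + count others (allFin n) ≤ deg G v
        fewer = count-mono-< (λ _ → proj₁ ∘ Equivalence.to T-∧) (∈-allFin r) ¬others-r vr
          where
          ¬others-r : ¬ T (others r)
          ¬others-r others-r = subst (T ∘ not) (dec-true (r ≟ᶠ r) refl) (proj₂ (Equivalence.to T-∧ others-r))
        covered′ : ∀ {f} → f ∈ L v → f ∈ [ φ v ] ⊎ ∃ λ w → T (others w) × φ w ≡ f
        covered′ f∈Lv with covered _ f∈Lv
        ... | inj₁ f≡φv = inj₁ (here f≡φv)
        ... | inj₂ (w , vw , w≢r , φw≡f) =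
          inj₂ (w , Equivalence.from T-∧ (vw , Equivalence.from T-not-≡ (dec-false (w ≟ᶠ r) w≢r)) , φw≡f)

module _ {n : ℕ} (G : Graph n) (L : ListAssignment G) (v : Fin n) where

  Lifted : Coloring G → Coloring G → Set
  Lifted φ σ′ = Σ (Coloring G) λ φ′ → LColoring G L φ′ × LEquivalent G L φ φ′ × AgreeOff v φ′ σ′

  Lifted-single : ∀ {φ φ′ σ′} → LValidKempe G L φ φ′ → AgreeOff v φ′ σ′ → Lifted φ σ′
  Lifted-single {φ′ = φ′} k φ′≈σ′ = φ′ , proj₁ (proj₂ k) , return k , φ′≈σ′

  Lifted-prepend : ∀ {φ φ₁ σ′} → LValidKempe G L φ φ₁ → Lifted φ₁ σ′ → Lifted φ σ′
  Lifted-prepend k (φ′ , lφ′ , φ₁~φ′ , φ′≈σ′) = φ′ , lφ′ , k ◅ φ₁~φ′ , φ′≈σ′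

  module KempeStep {σ σ′ : Coloring G} {a b : ℕ} {s : Fin n} (a≢b : a ≢ b) (s≢v : s ≢ v)
    (lσ′ : LColoring (isolate G v) L σ′)
    (s-col : Colored₂ (isolate G v) σ a b s) (swap : ChainSwap (isolate G v) σ σ′ a b s) where

    C : Fin n → Set
    C = InKempeChain (isolate G v) σ a b s

    C-≢v : ∀ {u} → C u → u ≢ v
    C-≢v c = Reach-isolate-≢ G v c s≢v

    module _ {φ : Coloring G} (lφ : LColoring G L φ) (φ≈σ : AgreeOff v φ σ) where

      Col-transfer : ∀ {u} → u ≢ v → Col₂ a b (σ u) → Col₂ a b (φ u)
      Col-transfer {u} u≢v = subst (Col₂ a b) (sym (φ≈σ u u≢v))

      C-col : ∀ {u} → C u → Col₂ a b (φ u)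
      C-col c = Col-transfer (C-≢v c) (Reach-last (isolate G v) c)

      σ′-on-C : ∀ {w} → C w → σ′ w ≡ swapCol G a b (φ w)
      σ′-on-C {w} c = trans (proj₁ (swap w) c) (cong (swapCol G a b) (sym (φ≈σ w (C-≢v c))))

      σ′-off-C : ∀ {w} → w ≢ v → ¬ C w → σ′ w ≡ φ w
      σ′-off-C {w} w≢v ¬c = trans (proj₂ (swap w) ¬c) (sym (φ≈σ w w≢v))

      C⊆chain : ∀ {u} → C u → InKempeChain G φ a b s u
      C⊆chain = Reach-isolate⁻ G v Col-transfer s≢v

      neighbour-in-C : Col₂ a b (φ v) → ∀ {u} → Adj G v u → C u → φ u ≡ swapCol G a b (φ v)
      neighbour-in-C col-v vu c = Col₂-other G a≢b col-v (C-col c) (≢-sym (proj₁ lφ _ _ vu))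

      ChainAvoids : Set
      ChainAvoids = Col₂ a b (φ v) → ∀ u → Adj G v u → ¬ C u

      chain⊆C : ChainAvoids → ∀ {u} → InKempeChain G φ a b s u → C u
      chain⊆C avoids = Reach-invariant G C extend (here s-col)
        where
        extend : ∀ {u w} → C u → Col₂ a b (φ u) → Adj G u w → Col₂ a b (φ w) → C w
        extend {u} {w} c _ uw col-w with w ≟ᶠ v
        ... | yes refl = contradiction c (avoids col-w u (Adj-sym G uw))
        ... | no w≢v = Reach-snoc (isolate G v) c (Adj-isolate⁺ G v (C-≢v c) w≢v uw)
                                    (subst (Col₂ a b) (φ≈σ w w≢v) col-w)

      kempe-keeping : ChainAvoids → LValidKempe G L φ (recolour σ′ v (φ v))
      kempe-keeping avoids =
        lφ , LColoring-recolour G L lσ′ (proj₂ lφ v) φv-free , a , b , s , Col-transfer s≢v s-col , swap′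
        where
        φv-free : UnusedAround G v σ′ (φ v)
        φv-free w vw σ′w≡φv = proj₁ lφ v w vw (sym (trans (sym (σ′-off-C w≢v ¬c)) σ′w≡φv))
          where
          w≢v : w ≢ v
          w≢v w≡v = Adj-irrefl G vw (sym w≡v)
          ¬c : ¬ C w
          ¬c c = avoids (subst (Col₂ a b) (trans (sym (σ′-on-C c)) σ′w≡φv) (swapCol-col G a≢b (C-col c)))
                        w vw c
        swap′ : ChainSwap G φ (recolour σ′ v (φ v)) a b s
        swap′ w = on-chain , off-chain
          where
          on-chain : InKempeChain G φ a b s w → recolour σ′ v (φ v) w ≡ swapCol G a b (φ w)
          on-chain in-chain = trans (recolour-other {φ = σ′} (C-≢v c)) (σ′-on-C c)
            where
            c : C w
            c = chain⊆C avoids in-chain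
          off-chain : ¬ InKempeChain G φ a b s w → recolour σ′ v (φ v) w ≡ φ w
          off-chain ¬in-chain with w ≟ᶠ v
          ... | yes refl = refl
          ... | no w≢v = σ′-off-C w≢v (¬in-chain ∘ C⊆chain)

      module _ (col-v : Col₂ a b (φ v)) {w₀ : Fin n} (vw₀ : Adj G v w₀)
        (φw₀ : φ w₀ ≡ swapCol G a b (φ v))
        (w₀-unique : ∀ {w} → Adj G v w → φ w ≡ swapCol G a b (φ v) → w ≡ w₀)
        (swap-v∈Lv : swapCol G a b (φ v) ∈ L v) (w₀-moves : σ′ w₀ ≢ σ w₀) where

        private
          e : ℕ
          e = swapCol G a b (φ v)

        -- Membership in a Kempe chain is undecidable here, so the chain of φ is only pinned down up to ¬ ¬.
        ¬¬C-w₀ : ¬ ¬ C w₀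
        ¬¬C-w₀ ¬c = w₀-moves (proj₂ (swap w₀) ¬c)

        ¬¬chain-v : ¬ ¬ InKempeChain G φ a b s v
        ¬¬chain-v ¬in-chain = ¬¬C-w₀ (λ c → ¬in-chain (Reach-snoc G (C⊆chain c) (Adj-sym G vw₀) col-v))

        chain⇒v⊎¬¬C : ∀ {u} → InKempeChain G φ a b s u → u ≡ v ⊎ ¬ ¬ C u
        chain⇒v⊎¬¬C = Reach-invariant G (λ u → u ≡ v ⊎ ¬ ¬ C u) extend (inj₂ (λ ¬c → ¬c (here s-col)))
          where
          extend : ∀ {u w} → u ≡ v ⊎ ¬ ¬ C u → Col₂ a b (φ u) → Adj G u w → Col₂ a b (φ w) →
                   w ≡ v ⊎ ¬ ¬ C w
          extend {u} {w} Q-u _ uw col-w with w ≟ᶠ v | Q-u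
          ... | yes w≡v | _ = inj₁ w≡v
          ... | no _ | inj₁ refl = inj₂ (subst (¬_ ∘ ¬_ ∘ C) (sym w≡w₀) ¬¬C-w₀)
            where
            w≡w₀ : w ≡ w₀
            w≡w₀ = w₀-unique uw (Col₂-other G a≢b col-v col-w (≢-sym (proj₁ lφ _ _ uw)))
          ... | no w≢v | inj₂ ¬¬c =
            inj₂ (λ ¬c-w → ¬¬c (λ c → ¬c-w (Reach-snoc (isolate G v) c (Adj-isolate⁺ G v (C-≢v c) w≢v uw)
                                                          (subst (Col₂ a b) (φ≈σ w w≢v) col-w))))

        e-free : UnusedAround G v σ′ e
        e-free w vw σ′w≡e = ¬¬C-w₀ (λ c₀ → ¬c (subst C (sym w≡w₀) c₀))
          where
          w≢v : w ≢ v
          w≢v w≡v = Adj-irrefl G vw (sym w≡v)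
          ¬c : ¬ C w
          ¬c c = proj₁ lφ v w vw
                   (sym (swapCol-injective G a≢b (C-col c) col-v (trans (sym (σ′-on-C c)) σ′w≡e)))
          w≡w₀ : w ≡ w₀
          w≡w₀ = w₀-unique vw (trans (sym (σ′-off-C w≢v ¬c)) σ′w≡e)

        kempe-joining : LValidKempe G L φ (recolour σ′ v e)
        kempe-joining =
          lφ , LColoring-recolour G L lσ′ swap-v∈Lv e-free , a , b , s , Col-transfer s≢v s-col , swap′
          where
          swap′ : ChainSwap G φ (recolour σ′ v e) a b s
          swap′ w = on-chain , off-chain
            where
            on-chain : InKempeChain G φ a b s w → recolour σ′ v e w ≡ swapCol G a b (φ w)
            on-chain in-chain with w ≟ᶠ v | chain⇒v⊎¬¬C in-chain
            ... | yes refl | _ = refl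
            ... | no w≢v | inj₁ w≡v = contradiction w≡v w≢v
            ... | no _ | inj₂ ¬¬c = decidable-stable (σ′ w ≟ swapCol G a b (φ w)) (λ ≢ → ¬¬c (≢ ∘ σ′-on-C))
            off-chain : ¬ InKempeChain G φ a b s w → recolour σ′ v e w ≡ φ w
            off-chain ¬in-chain with w ≟ᶠ v
            ... | yes refl = contradiction ¬in-chain ¬¬chain-v
            ... | no w≢v = σ′-off-C w≢v (¬in-chain ∘ C⊆chain)

    Col₂? : ∀ c → Dec (Col₂ a b c)
    Col₂? c = c ≟ a ⊎-dec c ≟ b

    Free : Coloring G → ℕ → Set
    Free φ f = f ≢ a × f ≢ b × UnusedAround G v φ f

    Free? : ∀ φ f → Dec (Free φ f)
    Free? φ f = ¬? (f ≟ a) ×-dec ¬? (f ≟ b) ×-dec UnusedAround? G v φ f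

    ¬Free⇒used : ∀ {φ f} → ¬ Free φ f → Col₂ a b f ⊎ ∃ λ u → Adj G v u × φ u ≡ f
    ¬Free⇒used {φ} {f} ¬free with f ≟ a | f ≟ b
    ... | yes f≡a | _ = inj₁ (inj₁ f≡a)
    ... | no _ | yes f≡b = inj₁ (inj₂ f≡b)
    ... | no f≢a | no f≢b = inj₂ (¬UnusedAround⇒used G v (λ unused → ¬free (f≢a , f≢b , unused)))

    module _ (slack : deg G v < length (L v)) (unique-Lv : Unique (L v)) where

      module _ {φ : Coloring G} (col-v : Col₂ a b (φ v)) (no-free : ∀ {f} → f ∈ L v → ¬ Free φ f) where

        private
          e : ℕ
          e = swapCol G a b (φ v)

        used-except : ∀ {r f} → φ r ≡ e → f ∈ L v → f ≢ φ v →
          f ≡ e ⊎ ∃ λ w → Adj G v w × w ≢ r × φ w ≡ f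
        used-except {r} φr≡e f∈Lv f≢φv with ¬Free⇒used (no-free f∈Lv)
        ... | inj₁ col-f = inj₁ (Col₂-other G a≢b col-v col-f f≢φv)
        ... | inj₂ (u , vu , φu≡f) with u ≟ᶠ r
        ...   | no u≢r = inj₂ (u , vu , u≢r , φu≡f)
        ...   | yes refl = inj₁ (trans (sym φu≡f) φr≡e)

        covered-except : ∀ {r} → φ r ≡ e → (e ∈ L v → ∃ λ w → Adj G v w × w ≢ r × φ w ≡ e) →
          ∀ f → f ∈ L v → f ≡ φ v ⊎ ∃ λ w → Adj G v w × w ≢ r × φ w ≡ f
        covered-except φr≡e e-elsewhere f f∈Lv with f ≟ φ v
        ... | yes f≡φv = inj₁ f≡φv
        ... | no f≢φv with used-except φr≡e f∈Lv f≢φv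
        ...   | inj₁ refl = inj₂ (e-elsewhere f∈Lv)
        ...   | inj₂ w-coloured-f = inj₂ w-coloured-f

        swap-v∈Lv : ∀ {w₀} → Adj G v w₀ → φ w₀ ≡ e → e ∈ L v
        swap-v∈Lv vw₀ φw₀ = decidable-stable (e ∈? L v) λ e∉Lv →
          slack-uncovered G v L unique-Lv slack φ vw₀
            (covered-except φw₀ (λ e∈Lv → contradiction e∈Lv e∉Lv))

        swap-v-unique : ∀ {w₀} → Adj G v w₀ → φ w₀ ≡ e → ∀ {w} → Adj G v w → φ w ≡ e → w ≡ w₀
        swap-v-unique {w₀} vw₀ φw₀ {w} vw φw with w ≟ᶠ w₀
        ... | yes w≡w₀ = w≡w₀
        ... | no w≢w₀ = contradiction (covered-except φw (λ _ → w₀ , vw₀ , ≢-sym w≢w₀ , φw₀))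
                          (slack-uncovered G v L unique-Lv slack φ vw)

      lift-via-free : ∀ {φ} → LColoring G L φ → AgreeOff v φ σ → (∃ λ f → f ∈ L v × Free φ f) → Lifted φ σ′
      lift-via-free {φ} lφ φ≈σ (f , f∈Lv , f≢a , f≢b , f-free) =
        Lifted-prepend recolour-v (Lifted-single (kempe-keeping lφ₁ φ₁≈σ avoids) recolour-agrees)
        where
        lφ₁ : LColoring G L (recolour φ v f)
        lφ₁ = LColoring-recolour G L (LColoring-isolate G v lφ) f∈Lv f-free
        φ₁≈σ : AgreeOff v (recolour φ v f) σ
        φ₁≈σ w w≢v = trans (recolour-other {φ = φ} w≢v) (φ≈σ w w≢v)
        recolour-v : LValidKempe G L φ (recolour φ v f)
        recolour-v = singleVertexKempe G L lφ lφ₁ (λ w w≢v → recolour-other {φ = φ} w≢v)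
                       (λ u vu φu≡f → f-free u vu (trans φu≡f (recolour-self {φ = φ})))
        avoids : ChainAvoids lφ₁ φ₁≈σ
        avoids col-v _ _ _ with subst (Col₂ a b) (recolour-self {φ = φ}) col-v
        ... | inj₁ f≡a = f≢a f≡a
        ... | inj₂ f≡b = f≢b f≡b

      lift-through : ∀ {φ} → LColoring G L φ → AgreeOff v φ σ → (col-v : Col₂ a b (φ v)) →
        (no-free : ∀ {f} → f ∈ L v → ¬ Free φ f) →
        ∀ {w₀} → Adj G v w₀ → φ w₀ ≡ swapCol G a b (φ v) → Lifted φ σ′
      lift-through lφ φ≈σ col-v no-free {w₀} vw₀ φw₀ with σ′ w₀ ≟ σ w₀
      ... | no w₀-moves =
        Lifted-single (kempe-joining lφ φ≈σ col-v vw₀ φw₀ (swap-v-unique col-v no-free vw₀ φw₀)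
                                     (swap-v∈Lv col-v no-free vw₀ φw₀) w₀-moves) recolour-agrees
      ... | yes w₀-stays = Lifted-single (kempe-keeping lφ φ≈σ avoids) recolour-agrees
        where
        avoids : ChainAvoids lφ φ≈σ
        avoids _ u vu c
          with refl ← swap-v-unique col-v no-free vw₀ φw₀ vu (neighbour-in-C lφ φ≈σ col-v vu c) =
          swapCol-≢ G a≢b (Reach-last (isolate G v) c) (trans (sym (proj₁ (swap u) c)) w₀-stays)

      lift : ∀ {φ} → LColoring G L φ → AgreeOff v φ σ → Lifted φ σ′
      lift {φ} lφ φ≈σ with Col₂? (φ v)
      ... | no ¬col-v =
        Lifted-single (kempe-keeping lφ φ≈σ (λ col-v → contradiction col-v ¬col-v)) recolour-agrees
      ... | yes col-v with Any.any? (Free? φ) (L v)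
      ...   | yes ∃free = lift-via-free lφ φ≈σ (find ∃free)
      ...   | no ¬∃free with Fin.any? (λ w → T? (Graph.adj G v w) ×-dec φ w ≟ swapCol G a b (φ v))
      ...     | yes (w₀ , vw₀ , φw₀) =
        lift-through lφ φ≈σ col-v (λ f∈Lv free → ¬∃free (lose f∈Lv free)) vw₀ φw₀
      ...     | no ¬w₀ = Lifted-single (kempe-keeping lφ φ≈σ avoids) recolour-agrees
        where
        avoids : ChainAvoids lφ φ≈σ
        avoids col-v u vu c = ¬w₀ (u , vu , neighbour-in-C lφ φ≈σ col-v vu c)

  module _ (slack : deg G v < length (L v)) (unique-Lv : Unique (L v)) where

    lift-LValidKempe : ∀ {φ σ σ′} → LColoring G L φ → LValidKempe (isolate G v) L σ σ′ → AgreeOff v φ σ →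
      Lifted φ σ′
    lift-LValidKempe {φ} lφ (_ , lσ′ , a , b , s , s-col , swap) φ≈σ with a ≟ b | s ≟ᶠ v
    ... | yes refl | _ = φ , lφ , ε , λ w w≢v →
      trans (φ≈σ w w≢v) (sym (ChainSwap-same (isolate G v) swap w))
    ... | no _ | yes refl = φ , lφ , ε , λ w w≢v →
      trans (φ≈σ w w≢v) (sym (proj₂ (swap w) (λ c → w≢v (Reach-isolate-self G v c))))
    ... | no a≢b | no s≢v = KempeStep.lift a≢b s≢v lσ′ s-col swap slack unique-Lv lφ φ≈σ

    lift-LEquivalent : ∀ {σ σ′} → LEquivalent (isolate G v) L σ σ′ →
      ∀ {φ} → LColoring G L φ → AgreeOff v φ σ → Lifted φ σ′
    lift-LEquivalent ε {φ} lφ φ≈σ = φ , lφ , ε , φ≈σ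
    lift-LEquivalent (k ◅ ks) lφ φ≈σ
      with φ₁ , lφ₁ , φ~φ₁ , φ₁≈σ₁ ← lift-LValidKempe lφ k φ≈σ
      with φ₂ , lφ₂ , φ₁~φ₂ , φ₂≈σ₂ ← lift-LEquivalent ks lφ₁ φ₁≈σ₁ = φ₂ , lφ₂ , φ~φ₁ ◅◅ φ₁~φ₂ , φ₂≈σ₂

    LEquivalent-from-isolate : ∀ {φ ψ} → LColoring G L φ → LColoring G L ψ →
      LEquivalent (isolate G v) L φ ψ → LEquivalent G L φ ψ
    LEquivalent-from-isolate {φ} {ψ} lφ lψ φ~ψ
      with φ′ , lφ′ , φ~φ′ , φ′≈ψ ← lift-LEquivalent φ~ψ lφ (λ _ _ → refl) =
      φ~φ′ ◅◅ return (singleVertexKempe G L lφ′ lψ (λ w w≢v → sym (φ′≈ψ w w≢v)) ψv-free)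
      where
      ψv-free : UnusedAround G v φ′ (ψ v)
      ψv-free u vu φ′u≡ψv = proj₁ lψ v u vu (sym (trans (sym (φ′≈ψ u (≢-sym (Adj-irrefl G vu)))) φ′u≡ψv))

Connected : ∀ {n} (G : Graph n) → Fin n → Fin n → Set
Connected G = Reach G (λ _ → ⊤)

SlackConnected : ∀ {n} (G : Graph n) → ListAssignment G → Set
SlackConnected G L = ∀ w → ∃ λ s → Connected G w s × deg G s < length (L s)

degreeSum : ∀ {n} → Graph n → ℕ
degreeSum {n} G = sum (map (deg G) (allFin n))

Connected-deg-pos : ∀ {n} (G : Graph n) {u s} → Connected G u s → 0 < deg G u → 0 < deg G s
Connected-deg-pos G (here _) u-pos = u-pos
Connected-deg-pos G (step _ uw r) _ = Connected-deg-pos G r (deg-pos G (Adj-sym G uw))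

module _ {n : ℕ} (G : Graph n) (L : ListAssignment G) (v : Fin n) where

  degreeSum-isolate-< : 0 < deg G v → degreeSum (isolate G v) < degreeSum G
  degreeSum-isolate-< v-pos = sum-map-mono-< (deg-isolate-≤ G v) (∈-allFin v)
    (subst (_< deg G v) (sym (deg-isolate-self G v)) v-pos)

  DegreeAssignment-isolate : DegreeAssignment G L → DegreeAssignment (isolate G v) L
  DegreeAssignment-isolate da u = ≤-trans (deg-isolate-≤ G v u) (da u)

  SlackConnected-isolate : deg G v < length (L v) → DegreeAssignment G L → SlackConnected G L →
    SlackConnected (isolate G v) L
  SlackConnected-isolate v-slack da sc w with s , w~s , s-slack ← sc w = walk w~s s-slack
    where
    v-slack′ : deg (isolate G v) v < length (L v)
    v-slack′ = subst (_< length (L v)) (sym (deg-isolate-self G v)) (≤-<-trans z≤n v-slack)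
    walk : ∀ {u s} → Connected G u s → deg G s < length (L s) →
      ∃ λ s′ → Connected (isolate G v) u s′ × deg (isolate G v) s′ < length (L s′)
    walk {u} u~s s-slack with u ≟ᶠ v
    ... | yes refl = v , here tt , v-slack′
    walk (here _) s-slack | no _ = _ , here tt , ≤-<-trans (deg-isolate-≤ G v _) s-slack
    walk (step {v = u′} _ uu′ u′~s) s-slack | no u≢v with u′ ≟ᶠ v
    ... | yes refl = _ , here tt , <-≤-trans (deg-isolate-< G v uu′) (da _)
    ... | no u′≢v with s′ , u′~s′ , s′-slack ← walk u′~s s-slack =
      s′ , step tt (Adj-isolate⁺ G v u≢v u′≢v uu′) u′~s′ , s′-slack

module _ {n : ℕ} (G : Graph n) (L : ListAssignment G) (edgeless : ∀ u w → ¬ Adj G u w) where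

  edgeless-LColoring : ∀ {φ} → (∀ w → φ w ∈ L w) → LColoring G L φ
  edgeless-LColoring inL = (λ u w uw → contradiction uw (edgeless u w)) , inL

  -- The last step, at w₀, ends exactly at ψ rather than at a colouring only pointwise equal to it.
  edgeless-LEquivalent : Fin n → ∀ {φ ψ} → LColoring G L φ → LColoring G L ψ → LEquivalent G L φ ψ
  edgeless-LEquivalent w₀ {φ} {ψ} lφ lψ =
    towards-ψ (allFin n) ◅◅
    return (singleVertexKempe G L (lχ (allFin n)) lψ ψ≈χ (λ u w₀u → contradiction w₀u (edgeless w₀ u)))
    where
    χ : List (Fin n) → Coloring G
    χ [] = φ
    χ (x ∷ xs) = recolour (χ xs) x (ψ x)
    lχ : ∀ xs → LColoring G L (χ xs)
    lχ [] = lφ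
    lχ (x ∷ xs) = edgeless-LColoring inL
      where
      inL : ∀ w → χ (x ∷ xs) w ∈ L w
      inL w with w ≟ᶠ x
      ... | yes refl = proj₂ lψ w
      ... | no _ = proj₂ (lχ xs) w
    χ-∈ : ∀ {w} xs → w ∈ xs → χ xs w ≡ ψ w
    χ-∈ {w} (x ∷ xs) w∈ with w ≟ᶠ x | w∈
    ... | yes refl | _ = refl
    ... | no w≢x | here w≡x = contradiction w≡x w≢x
    ... | no _ | there w∈xs = χ-∈ xs w∈xs
    ψ≈χ : AgreeOff w₀ ψ (χ (allFin n))
    ψ≈χ w _ = sym (χ-∈ (allFin n) (∈-allFin w))
    towards-ψ : ∀ xs → LEquivalent G L φ (χ xs)
    towards-ψ [] = ε
    towards-ψ (x ∷ xs) = towards-ψ xs ◅◅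
      return (singleVertexKempe G L (lχ xs) (lχ (x ∷ xs)) (λ _ → recolour-other {φ = χ xs})
                                (λ u xu → contradiction xu (edgeless x u)))

  edgeless-LColoring-exists : SlackConnected G L → Σ (Coloring G) (LColoring G L)
  edgeless-LColoring-exists sc = (λ w → proj₁ (colour w)) , edgeless-LColoring (λ w → proj₂ (colour w))
    where
    isolated : ∀ {w s} → Connected G w s → s ≡ w
    isolated = Reach-invariant G (_≡ _) (λ {u} {w} _ _ uw _ → contradiction uw (edgeless u w)) refl
    colour : ∀ w → ∃ (_∈ L w)
    colour w with s , w~s , s-slack ← sc w
      with L w | subst (λ s → deg G s < length (L s)) (isolated w~s) s-slack
    ... | c ∷ _ | _ = c , here refl

SlackNonIsolated : ∀ {n} (G : Graph n) → ListAssignment G → Set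
SlackNonIsolated G L = ∃ λ v → 0 < deg G v × deg G v < length (L v)

SlackNonIsolated? : ∀ {n} (G : Graph n) (L : ListAssignment G) → Dec (SlackNonIsolated G L)
SlackNonIsolated? G L = Fin.any? (λ v → (0 <? deg G v) ×-dec (deg G v <? length (L v)))

¬SlackNonIsolated⇒edgeless : ∀ {n} (G : Graph n) (L : ListAssignment G) → SlackConnected G L →
  ¬ SlackNonIsolated G L → ∀ u w → ¬ Adj G u w
¬SlackNonIsolated⇒edgeless G L sc none u w uw with s , u~s , s-slack ← sc u =
  none (s , Connected-deg-pos G u~s (deg-pos G uw) , s-slack)

module _ {n : ℕ} (L : Fin n → List ℕ) (unique : ∀ v → Unique (L v)) where

  slackConnected⇒LEquivalent : Fin n → ∀ (G : Graph n) → Acc _<_ (degreeSum G) →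
    DegreeAssignment G L → SlackConnected G L →
    ∀ {φ ψ} → LColoring G L φ → LColoring G L ψ → LEquivalent G L φ ψ
  slackConnected⇒LEquivalent w₀ G (acc smaller) da sc {φ} {ψ} lφ lψ with SlackNonIsolated? G L
  ... | no none = edgeless-LEquivalent G L (¬SlackNonIsolated⇒edgeless G L sc none) w₀ lφ lψ
  ... | yes (v , v-pos , v-slack) =
    LEquivalent-from-isolate G L v v-slack (unique v) lφ lψ
      (slackConnected⇒LEquivalent w₀ (isolate G v) (smaller (degreeSum-isolate-< G L v v-pos))
        (DegreeAssignment-isolate G L v da) (SlackConnected-isolate G L v v-slack da sc)
        (LColoring-isolate G v lφ) (LColoring-isolate G v lψ))

  slackConnected⇒LColoring : ∀ (G : Graph n) → Acc _<_ (degreeSum G) →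
    DegreeAssignment G L → SlackConnected G L → Σ (Coloring G) (LColoring G L)
  slackConnected⇒LColoring G (acc smaller) da sc with SlackNonIsolated? G L
  ... | no none = edgeless-LColoring-exists G L (¬SlackNonIsolated⇒edgeless G L sc none) sc
  ... | yes (v , v-pos , v-slack)
    with σ , lσ ← slackConnected⇒LColoring (isolate G v) (smaller (degreeSum-isolate-< G L v v-pos))
                    (DegreeAssignment-isolate G L v da) (SlackConnected-isolate G L v v-slack da sc)
    with f , f∈Lv , f-unused ← free-colour G v L (unique v) v-slack σ =
    recolour σ v f , LColoring-recolour G L lσ f∈Lv f-unused

module Precolour {n : ℕ} (G : Graph n) (L : ListAssignment G) (x : Fin n) (a : ℕ) where

  H : Graph n
  H = isolate G x

  L′ : ListAssignment H
  L′ w = if does (w ≟ᶠ x) then [ a ] else (if Graph.adj G x w then delete a (L w) else L w)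

  data View (w : Fin n) : Set where
    at-x      : w ≡ x → L′ w ≡ [ a ] → View w
    neighbour : w ≢ x → Adj G x w → L′ w ≡ delete a (L w) → View w
    far       : w ≢ x → ¬ Adj G x w → L′ w ≡ L w → View w

  L′-off : ∀ {w} → w ≢ x → L′ w ≡ (if Graph.adj G x w then delete a (L w) else L w)
  L′-off {w} w≢x rewrite dec-false (w ≟ᶠ x) w≢x = refl

  L′-by-adj : ∀ {w b} → Graph.adj G x w ≡ b →
    (if Graph.adj G x w then delete a (L w) else L w) ≡ (if b then delete a (L w) else L w)
  L′-by-adj {w} = cong (if_then delete a (L w) else L w)

  view : ∀ w → View w
  view w with w ≟ᶠ x
  ... | yes refl = at-x refl (cong (if_then [ a ] else _) (dec-true (x ≟ᶠ x) refl))
  ... | no w≢x with Graph.adj G x w in adj≡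
  ...   | true = neighbour w≢x (subst T (sym adj≡) tt) (trans (L′-off w≢x) (L′-by-adj adj≡))
  ...   | false = far w≢x (subst T adj≡) (trans (L′-off w≢x) (L′-by-adj adj≡))

  IsListAssignment-precolour : IsListAssignment G L → IsListAssignment H L′
  IsListAssignment-precolour unique w with view w
  ... | at-x _ L′w≡ = subst Unique (sym L′w≡) (All.[] ∷ [])
  ... | neighbour _ _ L′w≡ = subst Unique (sym L′w≡) (Unique-delete (unique w))
  ... | far _ _ L′w≡ = subst Unique (sym L′w≡) (unique w)

  slack-precolour-self : deg H x < length (L′ x)
  slack-precolour-self with view x
  ... | at-x _ L′x≡ rewrite L′x≡ | deg-isolate-self G x = s≤s z≤n
  ... | neighbour x≢x _ _ = contradiction refl x≢x
  ... | far x≢x _ _ = contradiction refl x≢x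

  module _ (unique : IsListAssignment G L) (da : DegreeAssignment G L) where

    DegreeAssignment-precolour : DegreeAssignment H L′
    DegreeAssignment-precolour w with view w
    ... | at-x refl L′x≡ rewrite L′x≡ | deg-isolate-self G x = z≤n
    ... | neighbour _ xw L′w≡ rewrite L′w≡ =
      ≤-pred (≤-trans (deg-isolate-< G x (Adj-sym G xw)) (≤-trans (da w) (length-delete (unique w))))
    ... | far _ _ L′w≡ rewrite L′w≡ = ≤-trans (deg-isolate-≤ G x w) (da w)

    slack-precolour : ∀ {w} → w ≢ x → deg G w < length (L w) → deg H w < length (L′ w)
    slack-precolour {w} w≢x w-slack with view w
    ... | at-x w≡x _ = contradiction w≡x w≢x
    ... | neighbour _ xw L′w≡ rewrite L′w≡ =
      ≤-pred (≤-trans (s≤s (deg-isolate-< G x (Adj-sym G xw))) (≤-trans w-slack (length-delete (unique w))))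
    ... | far _ _ L′w≡ rewrite L′w≡ = ≤-<-trans (deg-isolate-≤ G x w) w-slack

    slack-precolour-neighbour : ∀ {w} → Adj G x w → a ∉ L w → deg H w < length (L′ w)
    slack-precolour-neighbour {w} xw a∉Lw with view w
    ... | at-x w≡x _ = contradiction (sym w≡x) (Adj-irrefl G xw)
    ... | neighbour _ _ L′w≡ rewrite L′w≡ | delete-∉ a∉Lw =
      <-≤-trans (deg-isolate-< G x (Adj-sym G xw)) (da w)
    ... | far _ ¬xw _ = contradiction xw ¬xw

  LColoring-precolour⁺ : ∀ {φ} → LColoring G L φ → φ x ≡ a → LColoring H L′ φ
  LColoring-precolour⁺ {φ} lφ φx≡a = proj₁ (LColoring-isolate G x lφ) , inL′
    where
    inL′ : ∀ w → φ w ∈ L′ w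
    inL′ w with view w
    ... | at-x refl L′w≡ rewrite L′w≡ = here φx≡a
    ... | neighbour _ xw L′w≡ rewrite L′w≡ =
      ∈-delete⁺ (proj₂ lφ w) (λ φw≡a → proj₁ lφ x w xw (trans φx≡a (sym φw≡a)))
    ... | far _ _ L′w≡ rewrite L′w≡ = proj₂ lφ w

  module _ {φ : Coloring G} (lφ : LColoring H L′ φ) where

    precoloured : φ x ≡ a
    precoloured with view x | proj₂ lφ x
    ... | at-x _ L′x≡ | φx∈ with here φx≡a ← subst (φ x ∈_) L′x≡ φx∈ = φx≡a
    ... | neighbour x≢x _ _ | _ = contradiction refl x≢x
    ... | far x≢x _ _ | _ = contradiction refl x≢x

    precolour-avoids : ∀ {w} → Adj G x w → φ w ≢ a
    precolour-avoids {w} xw with view w | proj₂ lφ w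
    ... | at-x w≡x _ | _ = contradiction (sym w≡x) (Adj-irrefl G xw)
    ... | neighbour _ _ L′w≡ | φw∈ = proj₂ (∈-delete⁻ {xs = L w} (subst (φ w ∈_) L′w≡ φw∈))
    ... | far _ ¬xw _ | _ = contradiction xw ¬xw

    LColoring-precolour⁻ : a ∈ L x → LColoring G L φ
    LColoring-precolour⁻ a∈Lx = proper , inL
      where
      inL : ∀ w → φ w ∈ L w
      inL w with view w | proj₂ lφ w
      ... | at-x refl _ | _ = subst (_∈ L x) (sym precoloured) a∈Lx
      ... | neighbour _ _ L′w≡ | φw∈ = proj₁ (∈-delete⁻ {xs = L w} (subst (φ w ∈_) L′w≡ φw∈))
      ... | far _ _ L′w≡ | φw∈ = subst (φ w ∈_) L′w≡ φw∈
      proper : Proper G φ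
      proper u w uw with u ≟ᶠ x | w ≟ᶠ x
      ... | yes refl | yes refl = contradiction refl (Adj-irrefl G uw)
      ... | yes refl | no _ = λ φx≡φw → precolour-avoids uw (trans (sym φx≡φw) precoloured)
      ... | no _ | yes refl = λ φu≡φx → precolour-avoids (Adj-sym G uw) (trans φu≡φx precoloured)
      ... | no u≢x | no w≢x = proj₁ lφ u w (Adj-isolate⁺ G x u≢x w≢x uw)

  LValidKempe-precolour⁻ : a ∈ L x → ∀ {σ σ′} → LValidKempe H L′ σ σ′ → LValidKempe G L σ σ′
  LValidKempe-precolour⁻ a∈Lx {σ} {σ′} (lσ , lσ′ , c , d , s , s-col , swap) with c ≟ d
  ... | yes refl =
    LColoring-precolour⁻ lσ a∈Lx , LColoring-precolour⁻ lσ′ a∈Lx , c , c , s , s-col , λ w →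
      (λ _ → trans (ChainSwap-same H swap w) (sym (swapCol-same G c (σ w)))) , (λ _ → ChainSwap-same H swap w)
  ... | no c≢d = LColoring-precolour⁻ lσ a∈Lx , LColoring-precolour⁻ lσ′ a∈Lx , c , d , s , s-col , swap′
    where
    s≢x : s ≢ x
    s≢x refl = swapCol-≢ G c≢d s-col
      (trans (sym (proj₁ (swap x) (here s-col))) (trans (precoloured lσ′) (sym (precoloured lσ))))
    chain⊆H-chain : ∀ {w} → InKempeChain G σ c d s w → InKempeChain H σ c d s w
    chain⊆H-chain = Reach-invariant G (InKempeChain H σ c d s) extend (here s-col)
      where
      extend : ∀ {u w} → InKempeChain H σ c d s u → Col₂ c d (σ u) → Adj G u w → Col₂ c d (σ w) →
               InKempeChain H σ c d s w
      extend {u} {w} in-chain col-u uw col-w with w ≟ᶠ x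
      ... | yes refl =
        contradiction (trans (proj₁ (swap u) in-chain) (sym a≡swap)) (precolour-avoids lσ′ (Adj-sym G uw))
        where
        a≡swap : a ≡ swapCol G c d (σ u)
        a≡swap = Col₂-other G c≢d col-u (subst (Col₂ c d) (precoloured lσ) col-w)
                   (λ a≡σu → precolour-avoids lσ (Adj-sym G uw) (sym a≡σu))
      ... | no w≢x = Reach-snoc H in-chain (Adj-isolate⁺ G x (Reach-isolate-≢ G x in-chain s≢x) w≢x uw) col-w
    swap′ : ChainSwap G σ σ′ c d s
    swap′ w = proj₁ (swap w) ∘ chain⊆H-chain ,
              λ ¬in-chain → proj₂ (swap w) (¬in-chain ∘ Reach-isolate⁻ G x (λ _ col → col) s≢x)

module _ {n : ℕ} (G : Graph n) (L : ListAssignment G)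
  (unique : IsListAssignment G L) (da : DegreeAssignment G L) where

  precoloured-LEquivalent : ∀ {x a} → SpecialColor G L x a → ConnectedWithout G [ x ] →
    ∀ {φ ψ} → LColoring G L φ → LColoring G L ψ → φ x ≡ a → ψ x ≡ a → LEquivalent G L φ ψ
  precoloured-LEquivalent {x} {a} (u , xu , a∈Lx , a∉Lu) conn lφ lψ φx≡a ψx≡a =
    Star.map (LValidKempe-precolour⁻ a∈Lx)
      (slackConnected⇒LEquivalent L′ (IsListAssignment-precolour unique) x H (<-wellFounded _)
        (DegreeAssignment-precolour unique da) slack-connected
        (LColoring-precolour⁺ lφ φx≡a) (LColoring-precolour⁺ lψ ψx≡a))
    where
    open Precolour G L x a
    slack-connected : SlackConnected H L′
    slack-connected w with w ≟ᶠ x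
    ... | yes refl = x , here tt , slack-precolour-self
    ... | no w≢x = u , Reach-map H _ (Reach-isolate⁺ G x (λ z∉[x] z≡x → z∉[x] (here z≡x)) w~u)
                     , slack-precolour-neighbour unique da xu a∉Lu
      where
      w~u : Reach G (_∉ [ x ]) w u
      w~u = conn w u (λ { (here w≡x) → w≢x w≡x }) (λ { (here u≡x) → Adj-irrefl G xu (sym u≡x) })

  doubly-precoloured-LColoring : ∀ {x y a b} → x ≢ y → ¬ Adj G x y → SpecialColor G L x a → b ∈ L y →
    ConnectedWithout G (x ∷ y ∷ []) → Σ (Coloring G) λ θ → LColoring G L θ × θ x ≡ a × θ y ≡ b
  doubly-precoloured-LColoring {x} {y} {a} {b} x≢y ¬xy (u , xu , a∈Lx , a∉Lu) b∈Ly conn =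
    unprecolour (slackConnected⇒LColoring Py.L′ (Py.IsListAssignment-precolour unique₁) Py.H (<-wellFounded _)
                     (Py.DegreeAssignment-precolour unique₁ da₁) slack-connected)
    where
    module Px = Precolour G L x a
    module Py = Precolour Px.H Px.L′ y b
    unique₁ : IsListAssignment Px.H Px.L′
    unique₁ = Px.IsListAssignment-precolour unique
    da₁ : DegreeAssignment Px.H Px.L′
    da₁ = Px.DegreeAssignment-precolour unique da
    b∈L₁y : b ∈ Px.L′ y
    b∈L₁y with Px.view y
    ... | Px.at-x y≡x _ = contradiction (sym y≡x) x≢y
    ... | Px.neighbour _ xy _ = contradiction xy ¬xy
    ... | Px.far _ _ L₁y≡ = subst (b ∈_) (sym L₁y≡) b∈Ly
    unprecolour : Σ (Coloring G) (LColoring Py.H Py.L′) →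
      Σ (Coloring G) λ θ → LColoring G L θ × θ x ≡ a × θ y ≡ b
    unprecolour (θ , lθ) = θ , Px.LColoring-precolour⁻ lθ₁ a∈Lx , Px.precoloured lθ₁ , Py.precoloured lθ
      where
      lθ₁ : LColoring Px.H Px.L′ θ
      lθ₁ = Py.LColoring-precolour⁻ lθ b∈L₁y
    slack-connected : SlackConnected Py.H Py.L′
    slack-connected w with w ≟ᶠ x | w ≟ᶠ y
    ... | yes refl | _ = x , here tt , Py.slack-precolour unique₁ da₁ x≢y Px.slack-precolour-self
    ... | no _ | yes refl = y , here tt , Py.slack-precolour-self
    ... | no w≢x | no w≢y =
      u , Reach-map Py.H _ (Reach-isolate⁺ Px.H y (λ z∉ z≡y → z∉ (there (here z≡y)))
                             (Reach-isolate⁺ G x (λ z∉ z≡x → z∉ (here z≡x)) w~u))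
        , Py.slack-precolour unique₁ da₁ u≢y (Px.slack-precolour-neighbour unique da xu a∉Lu)
      where
      u≢y : u ≢ y
      u≢y refl = ¬xy xu
      u≢x : u ≢ x
      u≢x u≡x = Adj-irrefl G xu (sym u≡x)
      w~u : Reach G (_∉ x ∷ y ∷ []) w u
      w~u = conn w u (λ { (here w≡x) → w≢x w≡x ; (there (here w≡y)) → w≢y w≡y })
                     (λ { (here u≡x) → u≢x u≡x ; (there (here u≡y)) → u≢y u≡y })

lemma2p2 : ∀ (n : ℕ) (G : Graph n) → ThreeConnected G →
    (L : ListAssignment G) → IsListAssignment G L → DegreeAssignment G L →
    (x y : Fin n) → x ≢ y → ¬ Adj G x y →
    (a b : ℕ) → SpecialColor G L x a → SpecialColor G L y b →
    (φ ψ : Coloring G) → LColoring G L φ → LColoring G L ψ →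
    ((φ x ≡ a) ⊎ (φ y ≡ b)) → ((ψ x ≡ a) ⊎ (ψ y ≡ b)) →
    LEquivalent G L φ ψ
lemma2p2 n G (_ , conn) L unique da x y x≢y ¬xy a b special-x special-y@(_ , _ , b∈Ly , _)
         φ ψ lφ lψ φ-pre ψ-pre
  with θ , lθ , θx≡a , θy≡b ← doubly-precoloured-LColoring G L unique da x≢y ¬xy special-x b∈Ly
                                 (conn (x ∷ y ∷ []) (s≤s (s≤s (s≤s z≤n)))) =
  φ~θ φ-pre ◅◅ θ~ψ ψ-pre
  where
  x-class : ∀ {φ ψ} → LColoring G L φ → LColoring G L ψ → φ x ≡ a → ψ x ≡ a → LEquivalent G L φ ψ
  x-class = precoloured-LEquivalent G L unique da special-x (conn [ x ] (s≤s (s≤s z≤n)))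
  y-class : ∀ {φ ψ} → LColoring G L φ → LColoring G L ψ → φ y ≡ b → ψ y ≡ b → LEquivalent G L φ ψ
  y-class = precoloured-LEquivalent G L unique da special-y (conn [ y ] (s≤s (s≤s z≤n)))
  φ~θ : (φ x ≡ a) ⊎ (φ y ≡ b) → LEquivalent G L φ θ
  φ~θ (inj₁ φx≡a) = x-class lφ lθ φx≡a θx≡a
  φ~θ (inj₂ φy≡b) = y-class lφ lθ φy≡b θy≡b
  θ~ψ : (ψ x ≡ a) ⊎ (ψ y ≡ b) → LEquivalent G L θ ψ
  θ~ψ (inj₁ ψx≡a) = x-class lθ lψ θx≡a ψx≡a
  θ~ψ (inj₂ ψy≡b) = y-class lθ lψ θy≡b ψy≡b
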